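{- Let $V$ be a finite set and let $\mathcal{B}\subseteq 2^V$ be a Sperner hypergraph. Then the pure Horn function $h=\Phi_\mathcal{B}$ is the only pure Horn function $h:\{0,1\}^V\to\{0,1\}$ with $\mathcal{K}(h)=\mathcal{B}$ if and only if for all $T\in\mathcal{B}^d$ and all $v\in V\setminus T$ there exists $T'\in\mathcal{B}^d$ such that $T'\neq T$ and $T'\subseteq T\cup\{v\}$.
   Context: $V$ is a finite set of Boolean variables. A pure Horn clause is written as an implication $A\to v$ with $A\subseteq V$, $v\in V$; it stands for the clause $v\vee\bigvee_{a\in A}\bar a$. A Boolean function $h:\{0,1\}^V\to\{0,1\}$ is pure Horn if it can be represented by a conjunction of pure Horn clauses. A clause $A\to v$ is an implicate of $h$ if every $x$ with $h(x)=1$ satisfies $A\to v$. A set $K\subseteq V$ is a key of $h$ if $K\to v$ is an implicate of $h$ for all $v\in V\setminus K$; $\mathcal{K}(h)$ denotes the family of inclusion-wise minimal keys of $h$. A hypergraph $\mathcal{B}\subseteq 2^V$ is Sperner if no hyperedge contains another. A transversal of $\mathcal{B}$ is a set $T\subseteq V$ meeting every hyperedge; $\mathcal{B}^d$ is the family of inclusion-wise minimal transversals. For a Sperner hypergraph $\mathcal{B}$, $\Phi_\mathcal{B}=\bigwedge_{B\in\mathcal{B}}\bigwedge_{v\in V\setminus B}(B\to v)$ (it satisfies $\mathcal{K}(\Phi_\mathcal{B})=\mathcal{B}$). -}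

module Defs where

open import Data.Nat using (ℕ)
open import Data.Bool using (Bool; true; false; not; _∨_)
open import Data.Fin using (Fin)
open import Data.Fin.Subset using (Subset; _∈_; _∉_; _⊆_; _∪_; ⁅_⁆)
open import Data.Fin.Subset.Properties using (_∈?_; _⊆?_)
open import Data.List using (List; []; _∷_; concatMap; filter; allFin)
open import Data.Bool using (_∧_)
import Data.List.Membership.Propositional as L
open import Data.Product using (Σ; _×_; _,_; ∃)
open import Relation.Nullary using (¬_; ⌊_⌋)
open import Relation.Nullary.Decidable using (¬?)
open import Relation.Binary.PropositionalEquality using (_≡_; _≢_)
open import Function.Bundles using (_⇔_)

-- The variable set V is Fin n; a point x ∈ {0,1}^V is identified with the
-- set of variables it sets to 1, i.e. a  Subset n  (= Vec Bool n).

BoolFun : ℕ → Set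
BoolFun n = Subset n → Bool

Clause : ℕ → Set
Clause n = Subset n × Fin n

satClause : ∀ {n} → Clause n → Subset n → Bool
satClause (A , v) x = not ⌊ A ⊆? x ⌋ ∨ ⌊ v ∈? x ⌋

evalCNF : ∀ {n} → List (Clause n) → BoolFun n
evalCNF [] x = true
evalCNF (c ∷ cs) x = satClause c x ∧ evalCNF cs x

PureHorn : ∀ {n} → BoolFun n → Set
PureHorn {n} h = Σ (List (Clause n)) λ cs → ∀ x → h x ≡ evalCNF cs x

Implicate : ∀ {n} → BoolFun n → Subset n → Fin n → Set
Implicate h A v = ∀ x → h x ≡ true → A ⊆ x → v ∈ x

IsKey : ∀ {n} → BoolFun n → Subset n → Set
IsKey h K = ∀ v → v ∉ K → Implicate h K v

IsMinKey : ∀ {n} → BoolFun n → Subset n → Set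
IsMinKey h K = IsKey h K × (∀ K′ → K′ ⊆ K → IsKey h K′ → K′ ≡ K)

Hypergraph : ℕ → Set
Hypergraph n = List (Subset n)

Sperner : ∀ {n} → Hypergraph n → Set
Sperner 𝓑 = ∀ B B′ → B L.∈ 𝓑 → B′ L.∈ 𝓑 → B ⊆ B′ → B ≡ B′

MinKeysAre : ∀ {n} → BoolFun n → Hypergraph n → Set
MinKeysAre h 𝓑 = ∀ K → (K L.∈ 𝓑) ⇔ IsMinKey h K

IsTransversal : ∀ {n} → Hypergraph n → Subset n → Set
IsTransversal 𝓑 T = ∀ B → B L.∈ 𝓑 → ∃ λ v → v ∈ T × v ∈ B

IsMinTransversal : ∀ {n} → Hypergraph n → Subset n → Set
IsMinTransversal 𝓑 T =
  IsTransversal 𝓑 T × (∀ T′ → T′ ⊆ T → IsTransversal 𝓑 T′ → T′ ≡ T)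

ΦClauses : ∀ {n} → Hypergraph n → List (Clause n)
ΦClauses {n} 𝓑 =
  concatMap (λ B → Data.List.map (λ v → (B , v)) (filter (λ v → ¬? (v ∈? B)) (allFin n))) 𝓑

Φ : ∀ {n} → Hypergraph n → BoolFun n
Φ 𝓑 = evalCNF (ΦClauses 𝓑)

PhiUnique : ∀ {n} → Hypergraph n → Set
PhiUnique {n} 𝓑 =
  MinKeysAre (Φ 𝓑) 𝓑 ×
  (∀ (h : BoolFun n) → PureHorn h → MinKeysAre h 𝓑 → ∀ x → h x ≡ Φ 𝓑 x)

DualCondition : ∀ {n} → Hypergraph n → Set
DualCondition 𝓑 =
  ∀ T → IsMinTransversal 𝓑 T → ∀ v → v ∉ T →
    ∃ λ T′ → IsMinTransversal 𝓑 T′ × T′ ≢ T × T′ ⊆ T ∪ ⁅ v ⁆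

module Submission where

-- Say "K has an edge" when K contains a hyperedge.
-- For Sperner 𝓑, the minimal keys of h are 𝓑 iff the keys of h are exactly the
-- sets with an edge; Φ_𝓑 is the largest function whose keys include all edges.
-- Transversals are complements of edge-free sets, and every u in a minimal
-- transversal T is critical: ∁T ∪ {u} has an edge.
-- (⇐) Let h be pure Horn with the right keys, so h ≤ Φ_𝓑.  If a clause A → u
-- of h failed at an edge-free x, the dual condition yields a minimal
-- transversal T ⊆ ∁x through u; ∁T ⊇ A implies u and ∁T ∪ {u} is a key, so
-- the edge-free set ∁T would be a key.  Hence Φ_𝓑 ≤ h as well.
-- (⇒) If the condition fails at T and v, each w ∈ T is blocked: P ∪ {w} has an
-- edge, P = ∁(T ∪ {v}).  Then Φ_𝓑 ∧ (P → v) has the keys of Φ_𝓑 but rejects P.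
-- The file proceeds: subsets and minimality, CNF semantics, keys, then (in
-- Hypergraph-theory) transversals, Φ_𝓑, and the two directions.

open import Defs
open import Data.Nat using (ℕ)
open import Data.Bool using (true; _∧_)
import Data.Bool as Bool
open import Data.Bool.Properties using (⇔→≡)
open import Data.Fin using (Fin)
open import Data.Fin.Properties using (any?; _≟_)
open import Data.Fin.Subset using (Subset; _∈_; _∉_; _⊆_; _⊂_; _∪_; ∁; ⁅_⁆; _-_)
open import Data.Fin.Subset.Properties
  using (_∈?_; _⊆?_; _⊂?_; ⊆-refl; ⊆-trans; ⊆-antisym; anySubset?; x∈⁅x⁆; x∈⁅y⁆⇒x≡y;
         x∈∁p⇒x∉p; x∉∁p⇒x∈p; x∉p⇒x∈∁p; p⊆p∪q; q⊆p∪q; x∈p∪q⁻;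
         x∈p∧x≢y⇒x∈p-y; p─q⊆p; drop-there)
open import Data.Fin.Subset.Induction using (⊂-wellFounded; Acc; acc)
open import Data.List using (List; []; _∷_; allFin; filter)
import Data.Vec as Vec
import Data.List as List
import Data.List.Membership.Propositional as L
open import Data.List.Membership.Propositional using (find; lose)
open import Data.List.Membership.Propositional.Properties
  using (∈-concatMap⁺; ∈-concatMap⁻; ∈-map⁺; ∈-map⁻; ∈-filter⁺; ∈-filter⁻; ∈-allFin)
open import Data.List.Relation.Unary.Any using (here; there) renaming (any? to anyᴸ?)
open import Data.Product using (_×_; _,_; ∃; proj₁; proj₂)
open import Data.Sum using (_⊎_; inj₁; inj₂; [_,_]′)
open import Data.Empty using (⊥-elim)
open import Function using (_∘_; id)
open import Function.Bundles using (_⇔_; mk⇔; Equivalence)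
open import Relation.Nullary using (¬_; Dec; yes; no)
open import Relation.Nullary.Decidable using (¬?; _×-dec_; map′; decidable-stable)
open import Relation.Binary.PropositionalEquality using (_≡_; _≢_; refl; sym; trans; subst)

private
  variable
    n : ℕ

Minimal : (Subset n → Set) → Subset n → Set
Minimal Q K = Q K × (∀ K′ → K′ ⊆ K → Q K′ → K′ ≡ K)

⊆∧⊄⇒⊇ : {p q : Subset n} → p ⊆ q → ¬ (p ⊂ q) → q ⊆ p
⊆∧⊄⇒⊇ {p = p} p⊆q p⊄q {x} x∈q with x ∈? p
... | yes x∈p = x∈p
... | no x∉p = ⊥-elim (p⊄q (p⊆q , x , x∈q , x∉p))

minimalBelow : (Q : Subset n → Set) → (∀ X → Dec (Q X)) →
  ∀ {K} → Q K → ∃ λ K₀ → K₀ ⊆ K × Minimal Q K₀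
minimalBelow Q Q? {K} = descend K (⊂-wellFounded K)
  where
  descend : ∀ K → Acc _⊂_ K → Q K → ∃ λ K₀ → K₀ ⊆ K × Minimal Q K₀
  descend K (acc smaller) qK with anySubset? (λ K′ → (K′ ⊂? K) ×-dec Q? K′)
  ... | yes (K′ , K′⊂K , qK′) =
    let K₀ , K₀⊆K′ , minK₀ = descend K′ (smaller K′⊂K) qK′
    in K₀ , ⊆-trans K₀⊆K′ (proj₁ K′⊂K) , minK₀
  ... | no noneSmaller = K , ⊆-refl , qK , λ K′ K′⊆K qK′ →
    ⊆-antisym K′⊆K (⊆∧⊄⇒⊇ K′⊆K (λ K′⊂K → noneSmaller (K′ , K′⊂K , qK′)))

nonempty-member : {A : Set} (xs : List A) → xs ≢ [] → ∃ λ x → x L.∈ xs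
nonempty-member [] []≢[] = ⊥-elim ([]≢[] refl)
nonempty-member (x ∷ _) _ = x , here refl

⊈⇒witness : {p q : Subset n} → ¬ (p ⊆ q) → ∃ λ x → x ∈ p × x ∉ q
⊈⇒witness {p = p} {q} p⊈q with any? (λ x → (x ∈? p) ×-dec ¬? (x ∈? q))
... | yes witness = witness
... | no noWitness = ⊥-elim (p⊈q p⊆q)
  where
  p⊆q : p ⊆ q
  p⊆q {x} x∈p = decidable-stable (x ∈? q) (λ x∉q → noWitness (x , x∈p , x∉q))

∪⁅⁆-⊆ : {p q : Subset n} {x : Fin n} → p ⊆ q → x ∈ q → p ∪ ⁅ x ⁆ ⊆ q
∪⁅⁆-⊆ {p = p} {x = x} p⊆q x∈q y∈ with x∈p∪q⁻ p ⁅ x ⁆ y∈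
... | inj₁ y∈p = p⊆q y∈p
... | inj₂ y∈⁅x⁆ = subst (_∈ _) (sym (x∈⁅y⁆⇒x≡y x y∈⁅x⁆)) x∈q

⊆∁-swap : {p q : Subset n} → p ⊆ ∁ q → q ⊆ ∁ p
⊆∁-swap p⊆∁q y∈q = x∉p⇒x∈∁p (λ y∈p → x∈∁p⇒x∉p (p⊆∁q y∈p) y∈q)

⊆∪⁅x⁆∧x∉⇒⊆ : {p q : Subset n} {x : Fin n} → p ⊆ q ∪ ⁅ x ⁆ → x ∉ p → p ⊆ q
⊆∪⁅x⁆∧x∉⇒⊆ {q = q} {x} p⊆q∪x x∉p {y} y∈p with x∈p∪q⁻ q ⁅ x ⁆ (p⊆q∪x y∈p)
... | inj₁ y∈q = y∈q
... | inj₂ y∈⁅x⁆ = ⊥-elim (x∉p (subst (_∈ _) (x∈⁅y⁆⇒x≡y x y∈⁅x⁆) y∈p))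

x∉p-x : (p : Subset n) (x : Fin n) → x ∉ p - x
x∉p-x (_ Vec.∷ p) Fin.zero ()
x∉p-x (_ Vec.∷ p) (Fin.suc x) x∈ = x∉p-x p x (drop-there x∈)

∁[p-x]⊆∁p∪⁅x⁆ : (p : Subset n) (x : Fin n) → ∁ (p - x) ⊆ ∁ p ∪ ⁅ x ⁆
∁[p-x]⊆∁p∪⁅x⁆ p x {y} y∈ with y ≟ x
... | yes refl = q⊆p∪q (∁ p) ⁅ x ⁆ (x∈⁅x⁆ x)
... | no y≢x = p⊆p∪q ⁅ x ⁆ (x∉p⇒x∈∁p (λ y∈p → x∈∁p⇒x∉p y∈ (x∈p∧x≢y⇒x∈p-y y∈p y≢x)))

∧-true⁻ : ∀ {a b} → a ∧ b ≡ true → a ≡ true × b ≡ true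
∧-true⁻ {true} b≡true = refl , b≡true

∧-true⁺ : ∀ {a b} → a ≡ true → b ≡ true → a ∧ b ≡ true
∧-true⁺ refl refl = refl

satClause-sound : ∀ (A : Subset n) v x → satClause (A , v) x ≡ true → A ⊆ x → v ∈ x
satClause-sound A v x sat A⊆x with A ⊆? x | v ∈? x
satClause-sound A v x sat A⊆x | _ | yes v∈x = v∈x
satClause-sound A v x () A⊆x | yes _ | no _
satClause-sound A v x sat A⊆x | no A⊈x | no _ = ⊥-elim (A⊈x A⊆x)

satClause-complete : ∀ (A : Subset n) v x → (A ⊆ x → v ∈ x) → satClause (A , v) x ≡ true
satClause-complete A v x implies with A ⊆? x | v ∈? x
... | no _ | _ = refl
... | yes _ | yes _ = refl
... | yes A⊆x | no v∉x = ⊥-elim (v∉x (implies A⊆x))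

Satisfies : List (Clause n) → Subset n → Set
Satisfies cs x = ∀ {A v} → (A , v) L.∈ cs → A ⊆ x → v ∈ x

evalCNF-sound : (cs : List (Clause n)) (x : Subset n) → evalCNF cs x ≡ true → Satisfies cs x
evalCNF-sound (c ∷ cs) x true≡ (here refl) = satClause-sound _ _ x (proj₁ (∧-true⁻ true≡))
evalCNF-sound (c ∷ cs) x true≡ (there m) =
  evalCNF-sound cs x (proj₂ (∧-true⁻ {satClause c x} true≡)) m

evalCNF-complete : (cs : List (Clause n)) (x : Subset n) → Satisfies cs x → evalCNF cs x ≡ true
evalCNF-complete [] x sat = refl
evalCNF-complete ((A , v) ∷ cs) x sat =
  ∧-true⁺ (satClause-complete A v x (sat (here refl))) (evalCNF-complete cs x (sat ∘ there))

horn-implicate : {h : BoolFun n} (cs : List (Clause n)) → (∀ x → h x ≡ evalCNF cs x) →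
  ∀ {A v} → (A , v) L.∈ cs → Implicate h A v
horn-implicate cs h≡cs m x hx = evalCNF-sound cs x (trans (sym (h≡cs x)) hx) m

HasEdge : Hypergraph n → Subset n → Set
HasEdge 𝓑 K = ∃ λ B → B L.∈ 𝓑 × B ⊆ K

KeysAboveEdges : BoolFun n → Hypergraph n → Set
KeysAboveEdges h 𝓑 = ∀ K → IsKey h K ⇔ HasEdge 𝓑 K

isKey? : (h : BoolFun n) (K : Subset n) → Dec (IsKey h K)
isKey? h K with anySubset? (λ x → any? (λ v →
  ¬? (v ∈? K) ×-dec (h x Bool.≟ true) ×-dec (K ⊆? x) ×-dec ¬? (v ∈? x)))
... | yes (x , v , v∉K , hx , K⊆x , v∉x) = no (λ key → v∉x (key v v∉K x hx K⊆x))
... | no noCounterexample = yes λ v v∉K x hx K⊆x →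
  decidable-stable (v ∈? x) (λ v∉x → noCounterexample (x , v , v∉K , hx , K⊆x , v∉x))

key-mono : {h : BoolFun n} {K K′ : Subset n} → IsKey h K → K ⊆ K′ → IsKey h K′
key-mono key K⊆K′ v v∉K′ x hx K′⊆x = key v (v∉K′ ∘ K⊆K′) x hx (K′⊆x ∘ K⊆K′)

key-from-implied : {h : BoolFun n} {M : Subset n} {u : Fin n} →
  Implicate h M u → IsKey h (M ∪ ⁅ u ⁆) → IsKey h M
key-from-implied M→u key w _ x hx M⊆x =
  decidable-stable (w ∈? x) λ w∉x → w∉x (key w (w∉x ∘ M∪u⊆x) x hx M∪u⊆x)
  where
  M∪u⊆x = ∪⁅⁆-⊆ M⊆x (M→u x hx M⊆x)

module Hypergraph-theory {n : ℕ} (𝓑 : Hypergraph n) where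

  hasEdge? : ∀ X → Dec (HasEdge 𝓑 X)
  hasEdge? X = map′ find (λ (B , B∈ , B⊆X) → lose B∈ B⊆X) (anyᴸ? (_⊆? X) 𝓑)

  hasEdge-mono : ∀ {X Y} → X ⊆ Y → HasEdge 𝓑 X → HasEdge 𝓑 Y
  hasEdge-mono X⊆Y (B , B∈ , B⊆X) = B , B∈ , X⊆Y ∘ B⊆X

  edgeFree-missing : 𝓑 ≢ [] → ∀ {X} → ¬ HasEdge 𝓑 X → ∃ λ w → w ∉ X
  edgeFree-missing 𝓑≢[] edgeFree =
    let B , B∈ = nonempty-member 𝓑 𝓑≢[]
        w , _ , w∉X = ⊈⇒witness (λ B⊆X → edgeFree (B , B∈ , B⊆X))
    in w , w∉X

  transversal⇒edgeFree : ∀ {T} → IsTransversal 𝓑 T → ¬ HasEdge 𝓑 (∁ T)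
  transversal⇒edgeFree transT (B , B∈ , B⊆∁T) =
    let v , v∈T , v∈B = transT B B∈ in x∈∁p⇒x∉p (B⊆∁T v∈B) v∈T

  edgeFree⇒transversal : ∀ {T} → ¬ HasEdge 𝓑 (∁ T) → IsTransversal 𝓑 T
  edgeFree⇒transversal edgeFree B B∈ =
    let v , v∈B , v∉∁T = ⊈⇒witness (λ B⊆∁T → edgeFree (B , B∈ , B⊆∁T))
    in v , x∉∁p⇒x∈p v∉∁T , v∈B

  edgeFree⇒∁transversal : ∀ {X} → ¬ HasEdge 𝓑 X → IsTransversal 𝓑 (∁ X)
  edgeFree⇒∁transversal edgeFree =
    edgeFree⇒transversal (edgeFree ∘ hasEdge-mono (x∉∁p⇒x∈p ∘ x∈∁p⇒x∉p))

  transversal? : ∀ T → Dec (IsTransversal 𝓑 T)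
  transversal? T = map′ edgeFree⇒transversal transversal⇒edgeFree (¬? (hasEdge? (∁ T)))

  removal-exposes-edge : ∀ S w → ¬ IsTransversal 𝓑 (S - w) → HasEdge 𝓑 (∁ S ∪ ⁅ w ⁆)
  removal-exposes-edge S w notTrans = hasEdge-mono (∁[p-x]⊆∁p∪⁅x⁆ S w)
    (decidable-stable (hasEdge? (∁ (S - w))) (notTrans ∘ edgeFree⇒transversal))

  minTransversal-critical : ∀ {T u} → IsMinTransversal 𝓑 T → u ∈ T → HasEdge 𝓑 (∁ T ∪ ⁅ u ⁆)
  minTransversal-critical {T} {u} (_ , minimal) u∈T with transversal? (T - u)
  ... | yes transT-u = ⊥-elim (x∉p-x T u (subst (u ∈_) T-u≡T u∈T))
    where
    T-u≡T = sym (minimal (T - u) (p─q⊆p T ⁅ u ⁆) transT-u)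
  ... | no notTrans = removal-exposes-edge T u notTrans

  clausesOf : Subset n → List (Clause n)
  clausesOf B = List.map (B ,_) (filter (λ v → ¬? (v ∈? B)) (allFin n))

  ∈ΦClauses⁻ : ∀ {A v} → (A , v) L.∈ ΦClauses 𝓑 → A L.∈ 𝓑 × v ∉ A
  ∈ΦClauses⁻ {A} {v} m with find (∈-concatMap⁻ clausesOf {xs = 𝓑} m)
  ... | B , B∈ , m′ with ∈-map⁻ (B ,_) m′
  ... | v′ , v′∈ , refl = B∈ , proj₂ (∈-filter⁻ (λ v → ¬? (v ∈? B)) {xs = allFin n} v′∈)

  ∈ΦClauses⁺ : ∀ {B v} → B L.∈ 𝓑 → v ∉ B → (B , v) L.∈ ΦClauses 𝓑
  ∈ΦClauses⁺ {B} {v} B∈ v∉B = ∈-concatMap⁺ clausesOf (lose B∈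
    (∈-map⁺ (B ,_) (∈-filter⁺ (λ v → ¬? (v ∈? B)) (∈-allFin v) v∉B)))

  Φ-sound : ∀ {x B v} → Φ 𝓑 x ≡ true → B L.∈ 𝓑 → B ⊆ x → v ∉ B → v ∈ x
  Φ-sound {x} Φx B∈ B⊆x v∉B = evalCNF-sound (ΦClauses 𝓑) x Φx (∈ΦClauses⁺ B∈ v∉B) B⊆x

  Φ-complete : ∀ {x} → (∀ {B v} → B L.∈ 𝓑 → B ⊆ x → v ∉ B → v ∈ x) → Φ 𝓑 x ≡ true
  Φ-complete {x} closed = evalCNF-complete (ΦClauses 𝓑) x λ m A⊆x →
    closed (proj₁ (∈ΦClauses⁻ m)) A⊆x (proj₂ (∈ΦClauses⁻ m))

  Φ-full : ∀ {x} → Φ 𝓑 x ≡ true → HasEdge 𝓑 x → ∀ v → v ∈ x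
  Φ-full Φx (B , B∈ , B⊆x) v with v ∈? B
  ... | yes v∈B = B⊆x v∈B
  ... | no v∉B = Φ-sound Φx B∈ B⊆x v∉B

  Φ-edgeFree : ∀ {x} → ¬ HasEdge 𝓑 x → Φ 𝓑 x ≡ true
  Φ-edgeFree edgeFree = Φ-complete λ B∈ B⊆x _ → ⊥-elim (edgeFree (_ , B∈ , B⊆x))

  below-Φ : ∀ {h : BoolFun n} → (∀ B → B L.∈ 𝓑 → IsKey h B) → ∀ x → h x ≡ true → Φ 𝓑 x ≡ true
  below-Φ edgesAreKeys x hx = Φ-complete λ B∈ B⊆x v∉B → edgesAreKeys _ B∈ _ v∉B x hx B⊆x

  EdgeFreeModels : BoolFun n → Set
  EdgeFreeModels h = ∀ X → ¬ HasEdge 𝓑 X → ∃ λ y → X ⊆ y × ¬ HasEdge 𝓑 y × h y ≡ true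

  -- A function h ≤ Φ_𝓑 has the supersets of edges as its keys once its
  -- edge-free models are plentiful: each misses a vertex, so no edge-free set
  -- is a key, while a superset of an edge is a key of Φ_𝓑 and hence of h.
  keysAboveEdges-criterion : 𝓑 ≢ [] → ∀ {h : BoolFun n} →
    (∀ x → h x ≡ true → Φ 𝓑 x ≡ true) → EdgeFreeModels h → KeysAboveEdges h 𝓑
  keysAboveEdges-criterion 𝓑≢[] {h} h≤Φ models K = mk⇔ keyHasEdge edgeIsKey
    where
    keyHasEdge : IsKey h K → HasEdge 𝓑 K
    keyHasEdge key = decidable-stable (hasEdge? K) λ edgeFree →
      let y , K⊆y , yEdgeFree , hy = models K edgeFree
          w , w∉y = edgeFree-missing 𝓑≢[] yEdgeFree
      in w∉y (key w (w∉y ∘ K⊆y) y hy K⊆y)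
    edgeIsKey : HasEdge 𝓑 K → IsKey h K
    edgeIsKey (B , B∈ , B⊆K) v _ x hx K⊆x = Φ-full (h≤Φ x hx) (B , B∈ , K⊆x ∘ B⊆K) v

  -- The keys of Φ_𝓑 are the supersets of edges (edge-free sets are models).
  Φ-keys : 𝓑 ≢ [] → KeysAboveEdges (Φ 𝓑) 𝓑
  Φ-keys 𝓑≢[] = keysAboveEdges-criterion 𝓑≢[] (λ _ Φx → Φx)
    λ X edgeFree → X , ⊆-refl , edgeFree , Φ-edgeFree edgeFree

  -- If the minimal keys of h are the edges, its keys are the supersets of edges,
  -- since every key contains a minimal key.
  minKeys⇒keysAboveEdges : ∀ {h : BoolFun n} → MinKeysAre h 𝓑 → KeysAboveEdges h 𝓑
  minKeys⇒keysAboveEdges {h} minKeys K = mk⇔ keyHasEdge edgeIsKey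
    where
    keyHasEdge : IsKey h K → HasEdge 𝓑 K
    keyHasEdge key = let K₀ , K₀⊆K , minK₀ = minimalBelow (IsKey h) (isKey? h) key
                     in K₀ , Equivalence.from (minKeys K₀) minK₀ , K₀⊆K
    edgeIsKey : HasEdge 𝓑 K → IsKey h K
    edgeIsKey (B , B∈ , B⊆K) = key-mono (proj₁ (Equivalence.to (minKeys B) B∈)) B⊆K

  keysAboveEdges⇒minKeys : Sperner 𝓑 → ∀ {h : BoolFun n} → KeysAboveEdges h 𝓑 → MinKeysAre h 𝓑
  keysAboveEdges⇒minKeys sperner {h} keys K = mk⇔ edgeIsMinKey minKeyIsEdge
    where
    edgeIsMinKey : K L.∈ 𝓑 → IsMinKey h K
    edgeIsMinKey K∈ = Equivalence.from (keys K) (K , K∈ , ⊆-refl) , λ K′ K′⊆K key →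
      let B , B∈ , B⊆K′ = Equivalence.to (keys K′) key
          B≡K = sperner B K B∈ K∈ (K′⊆K ∘ B⊆K′)
      in ⊆-antisym K′⊆K (subst (_⊆ K′) B≡K B⊆K′)
    minKeyIsEdge : IsMinKey h K → K L.∈ 𝓑
    minKeyIsEdge (key , minimal) =
      let B , B∈ , B⊆K = Equivalence.to (keys K) key
      in subst (L._∈ 𝓑) (minimal B B⊆K (Equivalence.from (keys B) (B , B∈ , ⊆-refl))) B∈

  -- Under the dual condition every transversal S through u contains a minimal
  -- transversal through u: if a minimal T ⊆ S misses u, the dual condition
  -- gives T′ ⊆ T ∪ {u} with T′ ≠ T, and minimality of T forces u ∈ T′.
  dual⇒minTransversalThrough : DualCondition 𝓑 → ∀ {S u} → IsTransversal 𝓑 S → u ∈ S →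
    ∃ λ T → T ⊆ S × IsMinTransversal 𝓑 T × u ∈ T
  dual⇒minTransversalThrough dual {S} {u} transS u∈S
    with minimalBelow (IsTransversal 𝓑) transversal? transS
  ... | T , T⊆S , minT with u ∈? T
  ...   | yes u∈T = T , T⊆S , minT , u∈T
  ...   | no u∉T with dual T minT u u∉T
  ...     | T′ , minT′ , T′≢T , T′⊆T∪u = T′ , ∪⁅⁆-⊆ T⊆S u∈S ∘ T′⊆T∪u , minT′ , u∈T′
    where
    u∈T′ : u ∈ T′
    u∈T′ = decidable-stable (u ∈? T′) λ u∉T′ →
      T′≢T (proj₂ minT T′ (⊆∪⁅x⁆∧x∉⇒⊆ T′⊆T∪u u∉T′) (proj₁ minT′))

  -- A clause A → u failing at x
  -- would give a minimal transversal T ⊆ ∁x through u; then ∁T ⊇ A implies u,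
  -- ∁T ∪ {u} is a key, hence so is the edge-free set ∁T — impossible.
  dual⇒Φ-below : DualCondition 𝓑 → ∀ {h : BoolFun n} (cs : List (Clause n)) →
    (∀ x → h x ≡ evalCNF cs x) → KeysAboveEdges h 𝓑 → ∀ x → Φ 𝓑 x ≡ true → h x ≡ true
  dual⇒Φ-below dual {h} cs h≡cs keys x Φx = trans (h≡cs x) (evalCNF-complete cs x clauseHolds)
    where
    clauseHolds : Satisfies cs x
    clauseHolds {A} {u} A→u∈cs A⊆x with u ∈? x | hasEdge? x
    ... | yes u∈x | _ = u∈x
    ... | no _ | yes edge = Φ-full Φx edge u
    ... | no u∉x | no edgeFree with dual⇒minTransversalThrough dual
                                     (edgeFree⇒∁transversal edgeFree) (x∉p⇒x∈∁p u∉x)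
    ...   | T , T⊆∁x , minT , u∈T = ⊥-elim (transversal⇒edgeFree (proj₁ minT) ∁T-hasEdge)
      where
      ∁T-implies-u : Implicate h (∁ T) u
      ∁T-implies-u z hz ∁T⊆z = horn-implicate cs h≡cs A→u∈cs z hz (∁T⊆z ∘ ⊆∁-swap T⊆∁x ∘ A⊆x)
      ∁T-key : IsKey h (∁ T)
      ∁T-key = key-from-implied ∁T-implies-u
                 (Equivalence.from (keys _) (minTransversal-critical minT u∈T))
      ∁T-hasEdge : HasEdge 𝓑 (∁ T)
      ∁T-hasEdge = Equivalence.to (keys (∁ T)) ∁T-key

  -- (⇐): Φ_𝓑 has minimal keys 𝓑, and any pure Horn h with minimal keys 𝓑
  -- satisfies h ≤ Φ_𝓑 (edges are keys) and Φ_𝓑 ≤ h (dual condition).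
  dual⇒uniqueness : Sperner 𝓑 → 𝓑 ≢ [] → DualCondition 𝓑 → PhiUnique 𝓑
  dual⇒uniqueness sperner 𝓑≢[] dual = keysAboveEdges⇒minKeys sperner (Φ-keys 𝓑≢[]) , agrees
    where
    agrees : ∀ h → PureHorn h → MinKeysAre h 𝓑 → ∀ x → h x ≡ Φ 𝓑 x
    agrees h (cs , h≡cs) minKeys x =
      ⇔→≡ (mk⇔ (below-Φ edgesAreKeys x) (dual⇒Φ-below dual cs h≡cs keys x))
      where
      keys : KeysAboveEdges h 𝓑
      keys = minKeys⇒keysAboveEdges minKeys
      edgesAreKeys : ∀ B → B L.∈ 𝓑 → IsKey h B
      edgesAreKeys B B∈ = Equivalence.from (keys B) (B , B∈ , ⊆-refl)

  -- The competitor of Φ_𝓑 for a failure of the dual condition at T and v: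
  -- Φ_𝓑 strengthened by the clause P → v, where P = ∁(T ∪ {v}).
  module Competitor (T : Subset n) (v : Fin n) where

    P : Subset n
    P = ∁ (T ∪ ⁅ v ⁆)

    h′ : BoolFun n
    h′ = evalCNF ((P , v) ∷ ΦClauses 𝓑)

    h′-pureHorn : PureHorn h′
    h′-pureHorn = (P , v) ∷ ΦClauses 𝓑 , λ _ → refl

    Blocked : Set
    Blocked = ∀ w → w ∈ T → HasEdge 𝓑 (P ∪ ⁅ w ⁆)

    -- Either T is blocked, or (T ∪ {v}) - w is a transversal for some w ∈ T;
    -- a minimal transversal inside it differs from T and lies in T ∪ {v}.
    blocked-or-witness :
      Blocked ⊎ (∃ λ T′ → IsMinTransversal 𝓑 T′ × T′ ≢ T × T′ ⊆ T ∪ ⁅ v ⁆)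
    blocked-or-witness with any? (λ w → (w ∈? T) ×-dec transversal? ((T ∪ ⁅ v ⁆) - w))
    ... | yes (w , w∈T , removable) =
      let T′ , T′⊆ , minT′ = minimalBelow (IsTransversal 𝓑) transversal? removable
          T′≢T : T′ ≢ T
          T′≢T T′≡T = x∉p-x (T ∪ ⁅ v ⁆) w (T′⊆ (subst (w ∈_) (sym T′≡T) w∈T))
      in inj₂ (T′ , minT′ , T′≢T , ⊆-trans T′⊆ (p─q⊆p (T ∪ ⁅ v ⁆) ⁅ w ⁆))
    ... | no noneRemovable = inj₁ λ w w∈T →
      removal-exposes-edge (T ∪ ⁅ v ⁆) w (λ removable → noneRemovable (w , w∈T , removable))

    P⊆∁T : P ⊆ ∁ T
    P⊆∁T z∈P = x∉p⇒x∈∁p (λ z∈T → x∈∁p⇒x∉p z∈P (p⊆p∪q ⁅ v ⁆ z∈T))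

    v∉P : v ∉ P
    v∉P v∈P = x∈∁p⇒x∉p v∈P (q⊆p∪q T ⁅ v ⁆ (x∈⁅x⁆ v))

    blocked-avoids-T : Blocked → ∀ {X} → P ⊆ X → ¬ HasEdge 𝓑 X → X ⊆ ∁ T
    blocked-avoids-T blocked P⊆X edgeFree {z} z∈X = x∉p⇒x∈∁p λ z∈T →
      edgeFree (hasEdge-mono (∪⁅⁆-⊆ P⊆X z∈X) (blocked z z∈T))

    -- When T is blocked, h′ has the same keys as Φ_𝓑: an edge-free X ⊇ P
    -- extends to the edge-free model X ∪ {v} ⊆ ∁T, any other one is a model.
    competitor-keys : 𝓑 ≢ [] → IsTransversal 𝓑 T → v ∉ T → Blocked → KeysAboveEdges h′ 𝓑
    competitor-keys 𝓑≢[] transT v∉T blocked =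
      keysAboveEdges-criterion 𝓑≢[] (λ _ → proj₂ ∘ ∧-true⁻) models
      where
      models : EdgeFreeModels h′
      models X edgeFree with P ⊆? X
      ... | yes P⊆X =
        X ∪ ⁅ v ⁆ , p⊆p∪q ⁅ v ⁆ , X∪v-edgeFree , ∧-true⁺ satisfied (Φ-edgeFree X∪v-edgeFree)
        where
        X∪v-edgeFree : ¬ HasEdge 𝓑 (X ∪ ⁅ v ⁆)
        X∪v-edgeFree = transversal⇒edgeFree transT
          ∘ hasEdge-mono (∪⁅⁆-⊆ (blocked-avoids-T blocked P⊆X edgeFree) (x∉p⇒x∈∁p v∉T))
        satisfied : satClause (P , v) (X ∪ ⁅ v ⁆) ≡ true
        satisfied = satClause-complete P v (X ∪ ⁅ v ⁆) (λ _ → q⊆p∪q X ⁅ v ⁆ (x∈⁅x⁆ v))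
      ... | no P⊈X = X , ⊆-refl , edgeFree , ∧-true⁺ vacuous (Φ-edgeFree edgeFree)
        where
        vacuous : satClause (P , v) X ≡ true
        vacuous = satClause-complete P v X (⊥-elim ∘ P⊈X)

    -- h′ rejects P, whereas Φ_𝓑 accepts the edge-free set P ⊆ ∁T.
    competitor-differs : IsTransversal 𝓑 T → h′ P ≢ Φ 𝓑 P
    competitor-differs transT h′P≡ΦP =
      v∉P (satClause-sound P v P (proj₁ (∧-true⁻ (trans h′P≡ΦP ΦP))) ⊆-refl)
      where
      ΦP : Φ 𝓑 P ≡ true
      ΦP = Φ-edgeFree (transversal⇒edgeFree transT ∘ hasEdge-mono P⊆∁T)

  -- (⇒): a blocked T would make the competitor h′ a second pure Horn function
  -- with minimal keys 𝓑; so T is not blocked, which yields the required T′.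
  uniqueness⇒dual : Sperner 𝓑 → 𝓑 ≢ [] → PhiUnique 𝓑 → DualCondition 𝓑
  uniqueness⇒dual sperner 𝓑≢[] (_ , unique) T minT v v∉T = [ refute , id ]′ blocked-or-witness
    where
    open Competitor T v
    refute : Blocked → ∃ λ T′ → IsMinTransversal 𝓑 T′ × T′ ≢ T × T′ ⊆ T ∪ ⁅ v ⁆
    refute blocked = ⊥-elim (competitor-differs (proj₁ minT)
      (unique h′ h′-pureHorn
        (keysAboveEdges⇒minKeys sperner (competitor-keys 𝓑≢[] (proj₁ minT) v∉T blocked)) P))

theorem1 : ∀ (n : ℕ) (𝓑 : Hypergraph n) → Sperner 𝓑 → 𝓑 ≢ [] →
    PhiUnique 𝓑 ⇔ DualCondition 𝓑
theorem1 n 𝓑 sperner 𝓑≢[] =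
  mk⇔ (uniqueness⇒dual sperner 𝓑≢[]) (dual⇒uniqueness sperner 𝓑≢[])
  where open Hypergraph-theory 𝓑
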